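{- Let $q\ge5$ be an integer and, for $n\ge0$, let $\hat a_n,\hat b_n,\hat c_n,\hat d_n,\hat e_n$ be the sums of the values of the vertices of types $A,B,C,D,E$, respectively, on level $n$ of the Pascal pyramid $\mathcal{PP}_{4,q}$. Then $\hat a_1=\hat b_1=\hat c_1=\hat d_1=\hat e_1=0$ and for every $n\ge1$: $$\hat a_{n+1}=2\hat a_n+2\hat b_n+2,\quad \hat b_{n+1}=(q-4)\hat a_n+(q-3)\hat b_n,\quad \hat c_{n+1}=2\hat c_n+4,$$ $$\hat d_{n+1}=\hat a_n+\hat c_n+3\hat d_n+2\hat e_n,\quad \hat e_{n+1}=\hat b_n+(q-4)\hat d_n+(q-2)\hat e_n.$$
   Context: Fix an integer $q\ge5$ and the regular tiling $\{4,q\}$ of the hyperbolic plane by congruent squares, $q$ squares meeting at each vertex; let $d$ be the edge length. Hyperbolic Pascal triangle $\mathcal{HPT}$ (a subgraph of the tiling), built row by row. Row $0$ is a single base vertex $V_0$. The leftmost and rightmost vertices of each row $j\ge1$ are called wingers; every other vertex of row $j\ge 2$ has type $A$ or $B$. From each vertex of row $j$ one draws, in order from left to right, its descending edges (tiling edges going away from $V_0$): $2$ from $V_0$ and from each winger, $q-2$ from each vertex of type $A$, $q-1$ from each vertex of type $B$. For two consecutive vertices of row $j$, the rightmost descending edge of the left one and the leftmost descending edge of the right one end at a common vertex of row $j+1$, which is of type $A$; the two outermost descending edges of row $j$ end at the two wingers of row $j+1$; all remaining descending edges end at distinct vertices of row $j+1$, which are of type $B$. Pascal pyramid $\mathcal{PP}_{4,q}$.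 Place $\mathcal{HPT}$ in the plane $\mathbf{H}^2\times\{0\}$ of $\mathbf{H}^2\times\mathbf{R}$ and copy it to the planes $\mathbf{H}^2\times\{kd\}$, $k=1,2,\dots$, with corresponding vertices on the same fibre (part of the square-prism tiling of $\mathbf{H}^2\times\mathbf{R}$). Vertices are pairs $(v,k)$, $v$ a vertex of $\mathcal{HPT}$, $k\in\mathbb{Z}_{\ge0}$; edges join $(v,k)$–$(w,k)$ for each edge $vw$ of $\mathcal{HPT}$, and $(v,k)$–$(v,k+1)$. Level $n$ is the set of $(v,k)$ with $v$ in row $r$ and $r+k=n$ (edge-distance $n$ from $(V_0,0)$). The value of a vertex is the number of shortest edge paths from $(V_0,0)$ to it. Vertex types on level $n\ge1$: type $1$: $(V_0,k)$, $k\ge1$, and $(w,0)$, $w$ a winger; type $A$ (resp. $B$): $(v,0)$ with $v$ of type $A$ (resp. $B$); type $C$: $(w,k)$, $w$ a winger, $k\ge1$; type $D$ (resp. $E$): $(v,k)$, $k\ge1$, $v$ of type $A$ (resp. $B$). Level $0$ has no vertices of types $A,\dots,E$. -}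

module Defs where

open import Data.Nat using (ℕ; zero; suc; _+_; _∸_; _≡ᵇ_)
open import Data.Bool using (Bool; true; false; if_then_else_)
open import Data.List using (List; []; _∷_; _++_; map; zip; zipWith; upTo; replicate)
open import Data.Nat.ListAction using (sum)
open import Data.Product using (_×_; _,_; proj₁; proj₂)

-- Kinds of vertices of the hyperbolic Pascal triangle HPT (for {4,q}):
-- the base vertex V₀, wingers, and vertices of type A and B.
data Kind : Set where
  V0 W KA KB : Kind

outdeg : ℕ → Kind → ℕ
outdeg q V0 = 2
outdeg q W  = 2
outdeg q KA = q ∸ 2
outdeg q KB = q ∸ 1

-- Given row j of HPT as a left-to-right list of (kind, value) pairs,
-- produce row j+1 as a list of (kind, sum of values of its parents in row j).
-- Each vertex with d descending edges contributes, left to right, its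
-- leftmost edge (shared with the left neighbour -> type A vertex, or the
-- left winger if it is the first vertex), d-2 private edges (type B
-- vertices), and its rightmost edge (shared with the right neighbour, or
-- the right winger if it is the last vertex).
children : ℕ → List (Kind × ℕ) → List (Kind × ℕ)
children q [] = []
children q ((t , x) ∷ rest) = (W , x) ∷ (replicate (outdeg q t ∸ 2) (KB , x) ++ go x rest)
  where
  go : ℕ → List (Kind × ℕ) → List (Kind × ℕ)
  go p [] = (W , p) ∷ []
  go p ((t , x) ∷ rest) = (KA , p + x) ∷ (replicate (outdeg q t ∸ 2) (KB , x) ++ go x rest)

rowTypes : ℕ → ℕ → List Kind
rowTypes q zero = V0 ∷ []
rowTypes q (suc r) = map proj₁ (children q (map (λ t → (t , 0)) (rowTypes q r)))

parentSum : ℕ → ℕ → List ℕ → List ℕ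
parentSum q r vals = map proj₂ (children q (zip (rowTypes q r) vals))

-- val q k r : values of the vertices (v,k), v in row r of HPT (left to right),
-- in the Pascal pyramid PP_{4,q}.  The value = number of shortest edge paths
-- from (V₀,0); since (v,k) is at distance r+k and its neighbours on level
-- r+k-1 are (p,k) for HPT-parents p of v and (v,k-1), this count is given by
-- the recursion below.
val : ℕ → ℕ → ℕ → List ℕ
val q zero zero = 1 ∷ []
val q zero (suc r) = parentSum q r (val q zero r)
val q (suc k) zero = val q k zero
val q (suc k) (suc r) = zipWith _+_ (parentSum q r (val q (suc k) r)) (val q k (suc r))

data PType : Set where
  T1 TA TB TC TD TE : PType

ptype : Kind → ℕ → PType
ptype V0 _ = T1
ptype W zero = T1
ptype W (suc _) = TC
ptype KA zero = TA
ptype KA (suc _) = TD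
ptype KB zero = TB
ptype KB (suc _) = TE

ptIndex : PType → ℕ
ptIndex T1 = 0
ptIndex TA = 1
ptIndex TB = 2
ptIndex TC = 3
ptIndex TD = 4
ptIndex TE = 5

_==ᵀ_ : PType → PType → Bool
s ==ᵀ t = ptIndex s ≡ᵇ ptIndex t

rowSum : PType → ℕ → List (Kind × ℕ) → ℕ
rowSum t k [] = 0
rowSum t k ((v , x) ∷ rest) = (if ptype v k ==ᵀ t then x else 0) + rowSum t k rest

-- sum of the values of the vertices of type t on level n (all (v,k) with
-- v in row r, r + k = n)
levelSum : ℕ → PType → ℕ → ℕ
levelSum q t n = sum (map (λ r → rowSum t (n ∸ r) (zip (rowTypes q r) (val q (n ∸ r) r))) (upTo (suc n)))

âₙ b̂ₙ ĉₙ d̂ₙ êₙ : ℕ → ℕ → ℕ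
âₙ q = levelSum q TA
b̂ₙ q = levelSum q TB
ĉₙ q = levelSum q TC
d̂ₙ q = levelSum q TD
êₙ q = levelSum q TE

-- Write y c r k for the total value of the vertices (v , k) of the pyramid with v of kind c ∈ {W, A, B}
-- in row r of HPT.  Going down one row of HPT maps these totals linearly: winger values stay on the
-- wingers, every value is passed to the type-A vertices on both of its sides (a winger's value to
-- one side only), and an A (resp. B) vertex passes its value to its q − 4 (resp. q − 3) private
-- type-B children; the fibre edge adds y c (r + 1) k to y c (r + 1) (k + 1).  Now â and b̂ are the
-- totals at height 0, while ĉ, d̂, ê sum y W, y A, y B over the heights k ≥ 1 of a level, so
-- summing the one-row map along a level gives the recurrences.  The base vertex V₀ is the only
-- vertex breaking the pattern, and it produces the constants.
module Submission where

open import Defs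
open import Data.Nat using (ℕ; zero; suc; _+_; _*_; _∸_; _≤_; _⊓_; s≤s; z≤n)
open import Data.Nat.Properties
  using (suc-injective; ≤-trans; +-assoc; +-comm; +-identityʳ; *-zeroʳ; *-distribˡ-+; ⊓-idem; +-∸-assoc; ∸-+-assoc; +-commutativeSemigroup)
open import Data.Nat.ListAction using (sum)
open import Data.Nat.Tactic.RingSolver using (solve-∀)
open import Data.Bool using (Bool; true; false; if_then_else_)
open import Data.List using (List; []; _∷_; _++_; map; zip; zipWith; replicate; length; applyUpTo)
open import Data.List.Properties using (map-∘; map-id; length-map; length-zipWith; map-upTo; ∷-injectiveˡ; ∷-injectiveʳ)
open import Data.Product using (_×_; _,_; proj₁; proj₂)
open import Function using (_∘_)
open import Relation.Binary.PropositionalEquality using (_≡_; refl; sym; trans; cong; cong₂; subst; module ≡-Reasoning)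
open import Algebra.Properties.CommutativeSemigroup +-commutativeSemigroup using (interchange; xy∙z≈zy∙x; xy∙z≈yz∙x)

open ≡-Reasoning

map-proj₁-zip : ∀ {A B : Set} (xs : List A) (ys : List B) → length xs ≡ length ys → map proj₁ (zip xs ys) ≡ xs
map-proj₁-zip []       []       _  = refl
map-proj₁-zip (x ∷ xs) (y ∷ ys) eq = cong (x ∷_) (map-proj₁-zip xs ys (suc-injective eq))

zip-map-proj₁-map-proj₂ : ∀ {A B : Set} (xys : List (A × B)) → zip (map proj₁ xys) (map proj₂ xys) ≡ xys
zip-map-proj₁-map-proj₂ []             = refl
zip-map-proj₁-map-proj₂ ((x , y) ∷ xys) = cong ((x , y) ∷_) (zip-map-proj₁-map-proj₂ xys)

Row : Set
Row = List (Kind × ℕ)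

kinds : Row → List Kind
kinds = map proj₁

_==ᴷ_ : Kind → Kind → Bool
V0 ==ᴷ V0 = true
W  ==ᴷ W  = true
KA ==ᴷ KA = true
KB ==ᴷ KB = true
_  ==ᴷ _  = false

select : Kind → Kind × ℕ → ℕ
select c (t , x) = if c ==ᴷ t then x else 0

kindSum : Kind → Row → ℕ
kindSum c = sum ∘ map (select c)

select-+ : ∀ c t x y → select c (t , x + y) ≡ select c (t , x) + select c (t , y)
select-+ c t x y with c ==ᴷ t
... | true  = refl
... | false = refl

kindSum-replicate-++ : ∀ c n e N → kindSum c (replicate n e ++ N) ≡ n * select c e + kindSum c N
kindSum-replicate-++ c zero    e N = refl
kindSum-replicate-++ c (suc n) e N =
  trans (cong (select c e +_) (kindSum-replicate-++ c n e N)) (sym (+-assoc (select c e) _ _))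

kindSum-zip-zipWith : ∀ c ts (xs ys : List ℕ) → length xs ≡ length ys →
  kindSum c (zip ts (zipWith _+_ xs ys)) ≡ kindSum c (zip ts xs) + kindSum c (zip ts ys)
kindSum-zip-zipWith c []       xs       ys       _  = refl
kindSum-zip-zipWith c (t ∷ ts) []       []       _  = refl
kindSum-zip-zipWith c (t ∷ ts) (x ∷ xs) (y ∷ ys) eq = begin
  select c (t , x + y) + kindSum c (zip ts (zipWith _+_ xs ys))
    ≡⟨ cong₂ _+_ (select-+ c t x y) (kindSum-zip-zipWith c ts xs ys (suc-injective eq)) ⟩
  (select c (t , x) + select c (t , y)) + (kindSum c (zip ts xs) + kindSum c (zip ts ys))
    ≡⟨ interchange (select c (t , x)) (select c (t , y)) (kindSum c (zip ts xs)) (kindSum c (zip ts ys)) ⟩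
  (select c (t , x) + kindSum c (zip ts xs)) + (select c (t , y) + kindSum c (zip ts ys)) ∎

rowSum≡kindSum : ∀ {t k c} → (∀ v → (ptype v k ==ᵀ t) ≡ (c ==ᴷ v)) → ∀ M → rowSum t k M ≡ kindSum c M
rowSum≡kindSum same []            = refl
rowSum≡kindSum same ((v , x) ∷ M) = cong₂ _+_ (cong (λ b → if b then x else 0) (same v)) (rowSum≡kindSum same M)

rowSum≡0 : ∀ {t k} → (∀ v → (ptype v k ==ᵀ t) ≡ false) → ∀ M → rowSum t k M ≡ 0
rowSum≡0 none []            = refl
rowSum≡0 none ((v , x) ∷ M) = cong₂ _+_ (cong (λ b → if b then x else 0) (none v)) (rowSum≡0 none M)

everyKind : {P : Kind → Set} → P V0 → P W → P KA → P KB → ∀ v → P v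
everyKind p _ _ _ V0 = p
everyKind _ p _ _ W  = p
everyKind _ _ p _ KA = p
everyKind _ _ _ p KB = p

data RowEnd : List Kind → Set where
  [W] : RowEnd (W ∷ [])
  A∷_ : ∀ {ts} → RowEnd ts → RowEnd (KA ∷ ts)
  B∷_ : ∀ {ts} → RowEnd ts → RowEnd (KB ∷ ts)

data RowShape : List Kind → Set where
  W∷_ : ∀ {ts} → RowEnd ts → RowShape (W ∷ ts)

kinds-B-block : ∀ n x x′ {G G′} → kinds G ≡ kinds G′ →
  kinds (replicate n (KB , x) ++ G) ≡ kinds (replicate n (KB , x′) ++ G′)
kinds-B-block zero    x x′ eq = eq
kinds-B-block (suc n) x x′ eq = cong (KB ∷_) (kinds-B-block n x x′ eq)

rowEnd-B-block : ∀ n x {G} → RowEnd (kinds G) → RowEnd (kinds (replicate n (KB , x) ++ G))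
rowEnd-B-block zero    x e = e
rowEnd-B-block (suc n) x e = B∷ rowEnd-B-block n x e

-- diagSum f n = Σ_{r + k = n} f r k
diagSum : (ℕ → ℕ → ℕ) → ℕ → ℕ
diagSum f zero    = f 0 0
diagSum f (suc n) = f 0 (suc n) + diagSum (λ r → f (suc r)) n

sum-applyUpTo≡diagSum : ∀ f n → sum (applyUpTo (λ r → f r (n ∸ r)) (suc n)) ≡ diagSum f n
sum-applyUpTo≡diagSum f zero    = +-identityʳ (f 0 0)
sum-applyUpTo≡diagSum f (suc n) = cong (f 0 (suc n) +_) (sum-applyUpTo≡diagSum (λ r → f (suc r)) n)

diagSum-suc : ∀ f n → diagSum f (suc n) ≡ diagSum (λ r k → f r (suc k)) n + f (suc n) 0
diagSum-suc f zero    = refl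
diagSum-suc f (suc n) =
  trans (cong (f 0 (suc (suc n)) +_) (diagSum-suc (λ r → f (suc r)) n)) (sym (+-assoc (f 0 (suc (suc n))) _ _))

diagSum-ground : ∀ f → (∀ r k → f r (suc k) ≡ 0) → ∀ n → diagSum f n ≡ f n 0
diagSum-ground f f≡0 zero    = refl
diagSum-ground f f≡0 (suc n) = cong₂ _+_ (f≡0 0 n) (diagSum-ground (λ r → f (suc r)) (λ r → f≡0 (suc r)) n)

diagSum-cong : ∀ {f g} → (∀ r k → f r k ≡ g r k) → ∀ n → diagSum f n ≡ diagSum g n
diagSum-cong f≗g zero    = f≗g 0 0
diagSum-cong f≗g (suc n) = cong₂ _+_ (f≗g 0 (suc n)) (diagSum-cong (λ r → f≗g (suc r)) n)

diagSum-+ : ∀ f g n → diagSum (λ r k → f r k + g r k) n ≡ diagSum f n + diagSum g n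
diagSum-+ f g zero    = refl
diagSum-+ f g (suc n) = begin
  f 0 (suc n) + g 0 (suc n) + diagSum (λ r k → f (suc r) k + g (suc r) k) n
    ≡⟨ cong (f 0 (suc n) + g 0 (suc n) +_) (diagSum-+ (λ r → f (suc r)) (λ r → g (suc r)) n) ⟩
  f 0 (suc n) + g 0 (suc n) + (diagSum (λ r → f (suc r)) n + diagSum (λ r → g (suc r)) n)
    ≡⟨ interchange (f 0 (suc n)) (g 0 (suc n)) _ _ ⟩
  diagSum f (suc n) + diagSum g (suc n) ∎

diagSum-* : ∀ a f n → diagSum (λ r k → a * f r k) n ≡ a * diagSum f n
diagSum-* a f zero    = refl
diagSum-* a f (suc n) =
  trans (cong (a * f 0 (suc n) +_) (diagSum-* a (λ r → f (suc r)) n)) (sym (*-distribˡ-+ a (f 0 (suc n)) _))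

diagSum-head : ∀ {f g} → (∀ r k → f (suc r) k ≡ g (suc r) k) → ∀ n → diagSum f n + g 0 n ≡ diagSum g n + f 0 n
diagSum-head {f} {g} f≗g zero    = +-comm (f 0 0) (g 0 0)
diagSum-head {f} {g} f≗g (suc n) = begin
  f 0 (suc n) + diagSum (λ r → f (suc r)) n + g 0 (suc n)
    ≡⟨ cong (λ s → f 0 (suc n) + s + g 0 (suc n)) (diagSum-cong f≗g n) ⟩
  f 0 (suc n) + diagSum (λ r → g (suc r)) n + g 0 (suc n)
    ≡⟨ xy∙z≈zy∙x (f 0 (suc n)) _ (g 0 (suc n)) ⟩
  g 0 (suc n) + diagSum (λ r → g (suc r)) n + f 0 (suc n) ∎

diagSum-upper-suc : ∀ (y s : ℕ → ℕ → ℕ) → (∀ k → y 0 k ≡ 0) →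
  (∀ r k → y (suc r) (suc k) ≡ s r (suc k) + y (suc r) k) → ∀ p →
  diagSum (λ r k → y r (suc k)) (suc p) ≡
    diagSum (λ r k → s r (suc k)) p + (diagSum (λ r k → y r (suc k)) p + y (suc p) 0)
diagSum-upper-suc y s y₀≡0 pascal p = begin
  y 0 (suc (suc p)) + diagSum (λ r k → y (suc r) (suc k)) p
    ≡⟨ cong (_+ diagSum (λ r k → y (suc r) (suc k)) p) (y₀≡0 (suc (suc p))) ⟩
  diagSum (λ r k → y (suc r) (suc k)) p                    ≡⟨ diagSum-cong pascal p ⟩
  diagSum (λ r k → s r (suc k) + y (suc r) k) p            ≡⟨ diagSum-+ (λ r k → s r (suc k)) (λ r → y (suc r)) p ⟩
  diagSum (λ r k → s r (suc k)) p + diagSum (λ r → y (suc r)) p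
    ≡⟨ cong (diagSum (λ r k → s r (suc k)) p +_)
         (trans (cong (_+ diagSum (λ r → y (suc r)) p) (sym (y₀≡0 (suc p)))) (diagSum-suc y p)) ⟩
  diagSum (λ r k → s r (suc k)) p + (diagSum (λ r k → y r (suc k)) p + y (suc p) 0) ∎

module _ (q : ℕ) where

  -- `children` recurses through a function local to its `where` block, which cannot be named;
  -- `childrenFrom` is a copy of it.  The metavariable `localGo` is solved to the local function by
  -- unification in `children-∷∷`, where the `with` makes its arguments distinct variables.
  childrenFrom : ℕ → Row → Row
  childrenFrom p []             = (W , p) ∷ []
  childrenFrom p ((t , x) ∷ L) = (KA , p + x) ∷ (replicate (outdeg q t ∸ 2) (KB , x) ++ childrenFrom x L)

  private
    localGo : Kind → ℕ → Row → ℕ → Row → Row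
    children-∷∷ : ∀ t x t′ x′ L → children q ((t , x) ∷ (t′ , x′) ∷ L) ≡
      (W , x) ∷ (replicate (outdeg q t ∸ 2) (KB , x) ++
        (KA , x + x′) ∷ (replicate (outdeg q t′ ∸ 2) (KB , x′) ++ localGo t x ((t′ , x′) ∷ L) x′ L))
    localGo = _
    children-∷∷ t x t′ x′ L with (t′ , x′) ∷ L
    ... | _ = refl

    localGo≗childrenFrom : ∀ t x L p M → localGo t x L p M ≡ childrenFrom p M
    localGo≗childrenFrom t x L p []             = refl
    localGo≗childrenFrom t x L p ((t′ , x′) ∷ M) =
      cong (λ R → (KA , p + x′) ∷ (replicate (outdeg q t′ ∸ 2) (KB , x′) ++ R)) (localGo≗childrenFrom t x L x′ M)

  children-∷ : ∀ t x L → children q ((t , x) ∷ L) ≡ (W , x) ∷ (replicate (outdeg q t ∸ 2) (KB , x) ++ childrenFrom x L)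
  children-∷ t x L = cong (λ R → (W , x) ∷ (replicate (outdeg q t ∸ 2) (KB , x) ++ R)) (localGo≗childrenFrom t x L x L)

  kinds-childrenFrom : ∀ p p′ L L′ → kinds L ≡ kinds L′ → kinds (childrenFrom p L) ≡ kinds (childrenFrom p′ L′)
  kinds-childrenFrom p p′ []             []               _  = refl
  kinds-childrenFrom p p′ ((t , x) ∷ L) ((t′ , x′) ∷ L′) eq with refl ← ∷-injectiveˡ eq =
    cong (KA ∷_) (kinds-B-block (outdeg q t ∸ 2) x x′ (kinds-childrenFrom x x′ L L′ (∷-injectiveʳ eq)))

  kinds-children : ∀ L L′ → kinds L ≡ kinds L′ → kinds (children q L) ≡ kinds (children q L′)
  kinds-children []             []               _  = refl
  kinds-children ((t , x) ∷ L) ((t′ , x′) ∷ L′) eq with refl ← ∷-injectiveˡ eq = begin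
    kinds (children q ((t , x) ∷ L))    ≡⟨ cong kinds (children-∷ t x L) ⟩
    W ∷ kinds (replicate (outdeg q t ∸ 2) (KB , x) ++ childrenFrom x L)
      ≡⟨ cong (W ∷_) (kinds-B-block (outdeg q t ∸ 2) x x′ (kinds-childrenFrom x x′ L L′ (∷-injectiveʳ eq))) ⟩
    W ∷ kinds (replicate (outdeg q t ∸ 2) (KB , x′) ++ childrenFrom x′ L′) ≡⟨ cong kinds (children-∷ t x′ L′) ⟨
    kinds (children q ((t , x′) ∷ L′)) ∎

  rowEnd-childrenFrom : ∀ p L → RowEnd (kinds (childrenFrom p L))
  rowEnd-childrenFrom p []            = [W]
  rowEnd-childrenFrom p ((t , x) ∷ L) = A∷ rowEnd-B-block (outdeg q t ∸ 2) x (rowEnd-childrenFrom x L)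

  rowShape-children : ∀ t x L → RowShape (kinds (children q ((t , x) ∷ L)))
  rowShape-children t x L =
    subst (RowShape ∘ kinds) (sym (children-∷ t x L)) (W∷ rowEnd-B-block (outdeg q t ∸ 2) x (rowEnd-childrenFrom x L))

  kindSum-childrenFrom-∷ : ∀ c p t x L → kindSum c (childrenFrom p ((t , x) ∷ L)) ≡
    select c (KA , p + x) + ((outdeg q t ∸ 2) * select c (KB , x) + kindSum c (childrenFrom x L))
  kindSum-childrenFrom-∷ c p t x L = cong (select c (KA , p + x) +_) (kindSum-replicate-++ c (outdeg q t ∸ 2) (KB , x) _)

  kindSum-W-childrenFrom : ∀ p L → RowEnd (kinds L) → kindSum W (childrenFrom p L) ≡ kindSum W L
  kindSum-W-childrenFrom p ((W , y) ∷ [])  [W]    = refl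
  kindSum-W-childrenFrom p ((KA , x) ∷ L) (A∷ e) =
    trans (kindSum-childrenFrom-∷ W p KA x L) (cong₂ _+_ (*-zeroʳ (outdeg q KA ∸ 2)) (kindSum-W-childrenFrom x L e))
  kindSum-W-childrenFrom p ((KB , x) ∷ L) (B∷ e) =
    trans (kindSum-childrenFrom-∷ W p KB x L) (cong₂ _+_ (*-zeroʳ (outdeg q KB ∸ 2)) (kindSum-W-childrenFrom x L e))

  -- Each value of L reaches the type-A children on both of its sides, except the last (a winger),
  -- whose right edge ends at a winger.
  kindSum-A-childrenFrom : ∀ p L → RowEnd (kinds L) →
    kindSum KA (childrenFrom p L) ≡ p + kindSum W L + 2 * (kindSum KA L + kindSum KB L)
  kindSum-A-childrenFrom p ((W , y) ∷ [])  [W]    = cong (λ w → p + w + 0) (sym (+-identityʳ y))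
  kindSum-A-childrenFrom p ((KA , x) ∷ L) (A∷ e) = begin
    kindSum KA (childrenFrom p ((KA , x) ∷ L))
      ≡⟨ kindSum-childrenFrom-∷ KA p KA x L ⟩
    p + x + ((outdeg q KA ∸ 2) * 0 + kindSum KA (childrenFrom x L))
      ≡⟨ cong (λ s → p + x + ((outdeg q KA ∸ 2) * 0 + s)) (kindSum-A-childrenFrom x L e) ⟩
    p + x + ((outdeg q KA ∸ 2) * 0 + (x + kindSum W L + 2 * (kindSum KA L + kindSum KB L)))
      ≡⟨ collect (outdeg q KA ∸ 2) p x (kindSum W L) (kindSum KA L) (kindSum KB L) ⟩
    p + kindSum W L + 2 * ((x + kindSum KA L) + kindSum KB L) ∎
    where
    collect : ∀ n p x w a b → p + x + (n * 0 + (x + w + 2 * (a + b))) ≡ p + w + 2 * ((x + a) + b)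
    collect = solve-∀
  kindSum-A-childrenFrom p ((KB , x) ∷ L) (B∷ e) = begin
    kindSum KA (childrenFrom p ((KB , x) ∷ L))
      ≡⟨ kindSum-childrenFrom-∷ KA p KB x L ⟩
    p + x + ((outdeg q KB ∸ 2) * 0 + kindSum KA (childrenFrom x L))
      ≡⟨ cong (λ s → p + x + ((outdeg q KB ∸ 2) * 0 + s)) (kindSum-A-childrenFrom x L e) ⟩
    p + x + ((outdeg q KB ∸ 2) * 0 + (x + kindSum W L + 2 * (kindSum KA L + kindSum KB L)))
      ≡⟨ collect (outdeg q KB ∸ 2) p x (kindSum W L) (kindSum KA L) (kindSum KB L) ⟩
    p + kindSum W L + 2 * (kindSum KA L + (x + kindSum KB L)) ∎
    where
    collect : ∀ n p x w a b → p + x + (n * 0 + (x + w + 2 * (a + b))) ≡ p + w + 2 * (a + (x + b))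
    collect = solve-∀

  kindSum-B-childrenFrom : ∀ p L → RowEnd (kinds L) →
    kindSum KB (childrenFrom p L) ≡ (q ∸ 4) * kindSum KA L + (q ∸ 3) * kindSum KB L
  kindSum-B-childrenFrom p ((W , y) ∷ [])  [W]    = sym (cong₂ _+_ (*-zeroʳ (q ∸ 4)) (*-zeroʳ (q ∸ 3)))
  kindSum-B-childrenFrom p ((KA , x) ∷ L) (A∷ e) = begin
    kindSum KB (childrenFrom p ((KA , x) ∷ L))
      ≡⟨ kindSum-childrenFrom-∷ KB p KA x L ⟩
    (q ∸ 2 ∸ 2) * x + kindSum KB (childrenFrom x L)
      ≡⟨ cong₂ (λ n s → n * x + s) (∸-+-assoc q 2 2) (kindSum-B-childrenFrom x L e) ⟩
    (q ∸ 4) * x + ((q ∸ 4) * kindSum KA L + (q ∸ 3) * kindSum KB L)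
      ≡⟨ collect (q ∸ 4) (q ∸ 3) x (kindSum KA L) (kindSum KB L) ⟩
    (q ∸ 4) * (x + kindSum KA L) + (q ∸ 3) * kindSum KB L ∎
    where
    collect : ∀ m n x a b → m * x + (m * a + n * b) ≡ m * (x + a) + n * b
    collect = solve-∀
  kindSum-B-childrenFrom p ((KB , x) ∷ L) (B∷ e) = begin
    kindSum KB (childrenFrom p ((KB , x) ∷ L))
      ≡⟨ kindSum-childrenFrom-∷ KB p KB x L ⟩
    (q ∸ 1 ∸ 2) * x + kindSum KB (childrenFrom x L)
      ≡⟨ cong₂ (λ n s → n * x + s) (∸-+-assoc q 1 2) (kindSum-B-childrenFrom x L e) ⟩
    (q ∸ 3) * x + ((q ∸ 4) * kindSum KA L + (q ∸ 3) * kindSum KB L)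
      ≡⟨ collect (q ∸ 4) (q ∸ 3) x (kindSum KA L) (kindSum KB L) ⟩
    (q ∸ 4) * kindSum KA L + (q ∸ 3) * (x + kindSum KB L) ∎
    where
    collect : ∀ m n x a b → n * x + (m * a + n * b) ≡ m * a + n * (x + b)
    collect = solve-∀

  kindSum-W-children : ∀ M → RowShape (kinds M) → kindSum W (children q M) ≡ kindSum W M
  kindSum-W-children ((W , x) ∷ L) (W∷ e) =
    trans (cong (kindSum W) (children-∷ W x L)) (cong (x +_) (kindSum-W-childrenFrom x L e))

  kindSum-A-children : ∀ M → RowShape (kinds M) →
    kindSum KA (children q M) ≡ kindSum W M + 2 * kindSum KA M + 2 * kindSum KB M
  kindSum-A-children ((W , x) ∷ L) (W∷ e) = begin
    kindSum KA (children q ((W , x) ∷ L))            ≡⟨ cong (kindSum KA) (children-∷ W x L) ⟩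
    kindSum KA (childrenFrom x L)                    ≡⟨ kindSum-A-childrenFrom x L e ⟩
    x + kindSum W L + 2 * (kindSum KA L + kindSum KB L)
      ≡⟨ cong (x + kindSum W L +_) (*-distribˡ-+ 2 (kindSum KA L) (kindSum KB L)) ⟩
    x + kindSum W L + (2 * kindSum KA L + 2 * kindSum KB L) ≡⟨ +-assoc (x + kindSum W L) _ _ ⟨
    x + kindSum W L + 2 * kindSum KA L + 2 * kindSum KB L ∎

  kindSum-B-children : ∀ M → RowShape (kinds M) →
    kindSum KB (children q M) ≡ (q ∸ 4) * kindSum KA M + (q ∸ 3) * kindSum KB M
  kindSum-B-children ((W , x) ∷ L) (W∷ e) =
    trans (cong (kindSum KB) (children-∷ W x L)) (kindSum-B-childrenFrom x L e)

  row : ℕ → ℕ → Row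
  row r k = zip (rowTypes q r) (val q k r)

  rowTypes-suc : ∀ r (vs : List ℕ) → length vs ≡ length (rowTypes q r) →
    kinds (children q (zip (rowTypes q r) vs)) ≡ rowTypes q (suc r)
  rowTypes-suc r vs eq = kinds-children _ _ (begin
    kinds (zip (rowTypes q r) vs)                ≡⟨ map-proj₁-zip (rowTypes q r) vs (sym eq) ⟩
    rowTypes q r                                 ≡⟨ map-id (rowTypes q r) ⟨
    map (proj₁ ∘ λ t → (t , 0)) (rowTypes q r)    ≡⟨ map-∘ (rowTypes q r) ⟩
    kinds (map (λ t → (t , 0)) (rowTypes q r))   ∎)

  zip-parentSum : ∀ r vs → length vs ≡ length (rowTypes q r) →
    zip (rowTypes q (suc r)) (parentSum q r vs) ≡ children q (zip (rowTypes q r) vs)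
  zip-parentSum r vs eq = trans (cong (λ ts → zip ts (parentSum q r vs)) (sym (rowTypes-suc r vs eq)))
                                (zip-map-proj₁-map-proj₂ (children q (zip (rowTypes q r) vs)))

  length-parentSum : ∀ r vs → length vs ≡ length (rowTypes q r) → length (parentSum q r vs) ≡ length (rowTypes q (suc r))
  length-parentSum r vs eq = begin
    length (map proj₂ C) ≡⟨ length-map proj₂ C ⟩
    length C             ≡⟨ length-map proj₁ C ⟨
    length (kinds C)     ≡⟨ cong length (rowTypes-suc r vs eq) ⟩
    length (rowTypes q (suc r)) ∎
    where
    C : Row
    C = children q (zip (rowTypes q r) vs)

  length-val : ∀ k r → length (val q k r) ≡ length (rowTypes q r)
  length-val zero    zero    = refl
  length-val zero    (suc r) = length-parentSum r (val q zero r) (length-val zero r)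
  length-val (suc k) zero    = length-val k zero
  length-val (suc k) (suc r) = begin
    length (zipWith _+_ xs ys)     ≡⟨ length-zipWith _+_ xs ys ⟩
    length xs ⊓ length ys
      ≡⟨ cong₂ _⊓_ (length-parentSum r (val q (suc k) r) (length-val (suc k) r)) (length-val k (suc r)) ⟩
    length (rowTypes q (suc r)) ⊓ length (rowTypes q (suc r)) ≡⟨ ⊓-idem _ ⟩
    length (rowTypes q (suc r))   ∎
    where
    xs ys : List ℕ
    xs = parentSum q r (val q (suc k) r)
    ys = val q k (suc r)

  row-zero : ∀ k → row 0 k ≡ (V0 , 1) ∷ []
  row-zero zero    = refl
  row-zero (suc k) = row-zero k

  row-ground : ∀ r → row (suc r) 0 ≡ children q (row r 0)
  row-ground r = zip-parentSum r (val q 0 r) (length-val 0 r)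

  kindSum-row-pascal : ∀ c r k →
    kindSum c (row (suc r) (suc k)) ≡ kindSum c (children q (row r (suc k))) + kindSum c (row (suc r) k)
  kindSum-row-pascal c r k = begin
    kindSum c (zip (rowTypes q (suc r)) (zipWith _+_ xs (val q k (suc r))))
      ≡⟨ kindSum-zip-zipWith c (rowTypes q (suc r)) xs (val q k (suc r)) (trans xs-length (sym (length-val k (suc r)))) ⟩
    kindSum c (zip (rowTypes q (suc r)) xs) + kindSum c (row (suc r) k)
      ≡⟨ cong (λ M → kindSum c M + kindSum c (row (suc r) k)) (zip-parentSum r (val q (suc k) r) (length-val (suc k) r)) ⟩
    kindSum c (children q (row r (suc k))) + kindSum c (row (suc r) k) ∎
    where
    xs : List ℕ
    xs = parentSum q r (val q (suc k) r)
    xs-length : length xs ≡ length (rowTypes q (suc r))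
    xs-length = length-parentSum r (val q (suc k) r) (length-val (suc k) r)

  rowShape-rowTypes : ∀ r → RowShape (rowTypes q (suc r))
  rowShape-rowTypes zero    = W∷ [W]
  rowShape-rowTypes (suc r) = next (rowTypes q (suc r)) (rowShape-rowTypes r)
    where
    next : ∀ ts → RowShape ts → RowShape (kinds (children q (map (λ t → (t , 0)) ts)))
    next (W ∷ ts) (W∷ _) = rowShape-children W 0 (map (λ t → (t , 0)) ts)

  rowShape-row : ∀ r k → RowShape (kinds (row (suc r) k))
  rowShape-row r k = subst RowShape (sym (map-proj₁-zip _ _ (sym (length-val k (suc r))))) (rowShape-rowTypes r)

  kindTotal : Kind → ℕ → ℕ → ℕ
  kindTotal c r k = kindSum c (row r k)

  childTotal : Kind → ℕ → ℕ → ℕ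
  childTotal c r k = kindSum c (children q (row r k))

  upperTotal : Kind → ℕ → ℕ
  upperTotal c p = diagSum (λ r k → kindTotal c r (suc k)) p

  childTotal-W : ∀ r k → childTotal W (suc r) k ≡ kindTotal W (suc r) k
  childTotal-W r k = kindSum-W-children (row (suc r) k) (rowShape-row r k)

  childTotal-A : ∀ r k → childTotal KA r k ≡ kindTotal W r k + 2 * kindTotal KA r k + 2 * kindTotal KB r k
  childTotal-A zero    k = trans (cong (kindSum KA ∘ children q) (row-zero k))
    (sym (cong (λ M → kindSum W M + 2 * kindSum KA M + 2 * kindSum KB M) (row-zero k)))
  childTotal-A (suc r) k = kindSum-A-children (row (suc r) k) (rowShape-row r k)

  childTotal-B : ∀ r k → childTotal KB r k ≡ (q ∸ 4) * kindTotal KA r k + (q ∸ 3) * kindTotal KB r k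
  childTotal-B zero    k = begin
    childTotal KB 0 k                                       ≡⟨ cong (kindSum KB ∘ children q) (row-zero k) ⟩
    0                                                       ≡⟨ cong₂ _+_ (*-zeroʳ (q ∸ 4)) (*-zeroʳ (q ∸ 3)) ⟨
    (q ∸ 4) * 0 + (q ∸ 3) * 0
      ≡⟨ cong (λ M → (q ∸ 4) * kindSum KA M + (q ∸ 3) * kindSum KB M) (row-zero k) ⟨
    (q ∸ 4) * kindTotal KA 0 k + (q ∸ 3) * kindTotal KB 0 k ∎
  childTotal-B (suc r) k = kindSum-B-children (row (suc r) k) (rowShape-row r k)

  kindTotal-root : ∀ c k → kindTotal c 0 k ≡ kindSum c ((V0 , 1) ∷ [])
  kindTotal-root c k = cong (kindSum c) (row-zero k)

  kindTotal-ground : ∀ c r → kindTotal c (suc r) 0 ≡ childTotal c r 0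
  kindTotal-ground c r = cong (kindSum c) (row-ground r)

  wingerTotal : ∀ r → kindTotal W (suc r) 0 ≡ 2
  wingerTotal zero    = refl
  wingerTotal (suc r) = trans (kindTotal-ground W (suc r)) (trans (childTotal-W r 0) (wingerTotal r))

  upperTotal-suc : ∀ c → (∀ k → kindTotal c 0 k ≡ 0) → ∀ p →
    upperTotal c (suc p) ≡ diagSum (λ r k → childTotal c r (suc k)) p + (upperTotal c p + kindTotal c (suc p) 0)
  upperTotal-suc c root≡0 = diagSum-upper-suc (kindTotal c) (childTotal c) root≡0 (kindSum-row-pascal c)

  -- Row 0 is the one row whose children carry a winger total (2) different from its own (0).
  upperChildTotal-W : ∀ p → diagSum (λ r k → childTotal W r (suc k)) p ≡ upperTotal W p + 2
  upperChildTotal-W p = begin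
    diagSum f p                             ≡⟨ +-identityʳ (diagSum f p) ⟨
    diagSum f p + 0                         ≡⟨ cong (diagSum f p +_) (kindTotal-root W (suc p)) ⟨
    diagSum f p + kindTotal W 0 (suc p)     ≡⟨ diagSum-head (λ r k → childTotal-W r (suc k)) p ⟩
    upperTotal W p + childTotal W 0 (suc p) ≡⟨ cong (λ M → upperTotal W p + kindSum W (children q M)) (row-zero (suc p)) ⟩
    upperTotal W p + 2                      ∎
    where
    f : ℕ → ℕ → ℕ
    f r k = childTotal W r (suc k)

  upperChildTotal-A : ∀ p →
    diagSum (λ r k → childTotal KA r (suc k)) p ≡ upperTotal W p + 2 * upperTotal KA p + 2 * upperTotal KB p
  upperChildTotal-A p = begin
    diagSum (λ r k → childTotal KA r (suc k)) p       ≡⟨ diagSum-cong (λ r k → childTotal-A r (suc k)) p ⟩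
    diagSum (λ r k → up W r k + 2 * up KA r k + 2 * up KB r k) p
      ≡⟨ diagSum-+ (λ r k → up W r k + 2 * up KA r k) (λ r k → 2 * up KB r k) p ⟩
    diagSum (λ r k → up W r k + 2 * up KA r k) p + diagSum (λ r k → 2 * up KB r k) p
      ≡⟨ cong₂ _+_ (diagSum-+ (up W) (λ r k → 2 * up KA r k) p) (diagSum-* 2 (up KB) p) ⟩
    upperTotal W p + diagSum (λ r k → 2 * up KA r k) p + 2 * upperTotal KB p
      ≡⟨ cong (λ s → upperTotal W p + s + 2 * upperTotal KB p) (diagSum-* 2 (up KA) p) ⟩
    upperTotal W p + 2 * upperTotal KA p + 2 * upperTotal KB p ∎
    where
    up : Kind → ℕ → ℕ → ℕ
    up c r k = kindTotal c r (suc k)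

  upperChildTotal-B : ∀ p →
    diagSum (λ r k → childTotal KB r (suc k)) p ≡ (q ∸ 4) * upperTotal KA p + (q ∸ 3) * upperTotal KB p
  upperChildTotal-B p = begin
    diagSum (λ r k → childTotal KB r (suc k)) p       ≡⟨ diagSum-cong (λ r k → childTotal-B r (suc k)) p ⟩
    diagSum (λ r k → (q ∸ 4) * up KA r k + (q ∸ 3) * up KB r k) p
      ≡⟨ diagSum-+ (λ r k → (q ∸ 4) * up KA r k) (λ r k → (q ∸ 3) * up KB r k) p ⟩
    diagSum (λ r k → (q ∸ 4) * up KA r k) p + diagSum (λ r k → (q ∸ 3) * up KB r k) p
      ≡⟨ cong₂ _+_ (diagSum-* (q ∸ 4) (up KA) p) (diagSum-* (q ∸ 3) (up KB) p) ⟩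
    (q ∸ 4) * upperTotal KA p + (q ∸ 3) * upperTotal KB p ∎
    where
    up : Kind → ℕ → ℕ → ℕ
    up c r k = kindTotal c r (suc k)

  levelSum≡diagSum : ∀ t n → levelSum q t n ≡ diagSum (λ r k → rowSum t k (row r k)) n
  levelSum≡diagSum t n = trans (cong sum (map-upTo _ (suc n))) (sum-applyUpTo≡diagSum (λ r k → rowSum t k (row r k)) n)

  levelSum-ground : ∀ {t c} →
    (∀ v → (ptype v 0 ==ᵀ t) ≡ (c ==ᴷ v)) → (∀ k v → (ptype v (suc k) ==ᵀ t) ≡ false) →
    ∀ n → levelSum q t n ≡ kindTotal c n 0
  levelSum-ground {t} ground above n = begin
    levelSum q t n                                     ≡⟨ levelSum≡diagSum t n ⟩
    diagSum (λ r k → rowSum t k (row r k)) n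
      ≡⟨ diagSum-ground (λ r k → rowSum t k (row r k)) (λ r k → rowSum≡0 (above k) (row r (suc k))) n ⟩
    rowSum t 0 (row n 0)                               ≡⟨ rowSum≡kindSum ground (row n 0) ⟩
    kindTotal _ n 0 ∎

  levelSum-upper : ∀ {t c} →
    (∀ v → (ptype v 0 ==ᵀ t) ≡ false) → (∀ k v → (ptype v (suc k) ==ᵀ t) ≡ (c ==ᴷ v)) →
    ∀ p → levelSum q t (suc p) ≡ upperTotal c p
  levelSum-upper {t} {c} ground above p = begin
    levelSum q t (suc p)                                             ≡⟨ levelSum≡diagSum t (suc p) ⟩
    diagSum (λ r k → rowSum t k (row r k)) (suc p)                   ≡⟨ diagSum-suc (λ r k → rowSum t k (row r k)) p ⟩
    diagSum (λ r k → rowSum t (suc k) (row r (suc k))) p + rowSum t 0 (row (suc p) 0)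
      ≡⟨ cong₂ _+_ (diagSum-cong (λ r k → rowSum≡kindSum (above k) (row r (suc k))) p)
                   (rowSum≡0 ground (row (suc p) 0)) ⟩
    upperTotal c p + 0                                               ≡⟨ +-identityʳ _ ⟩
    upperTotal c p ∎

  â-level : ∀ n → âₙ q n ≡ kindTotal KA n 0
  â-level = levelSum-ground (everyKind refl refl refl refl) (λ _ → everyKind refl refl refl refl)

  b̂-level : ∀ n → b̂ₙ q n ≡ kindTotal KB n 0
  b̂-level = levelSum-ground (everyKind refl refl refl refl) (λ _ → everyKind refl refl refl refl)

  ĉ-level : ∀ p → ĉₙ q (suc p) ≡ upperTotal W p
  ĉ-level = levelSum-upper (everyKind refl refl refl refl) (λ _ → everyKind refl refl refl refl)

  d̂-level : ∀ p → d̂ₙ q (suc p) ≡ upperTotal KA p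
  d̂-level = levelSum-upper (everyKind refl refl refl refl) (λ _ → everyKind refl refl refl refl)

  ê-level : ∀ p → êₙ q (suc p) ≡ upperTotal KB p
  ê-level = levelSum-upper (everyKind refl refl refl refl) (λ _ → everyKind refl refl refl refl)

  â-suc : ∀ p → âₙ q (suc (suc p)) ≡ 2 * âₙ q (suc p) + 2 * b̂ₙ q (suc p) + 2
  â-suc p = begin
    âₙ q (suc (suc p))                    ≡⟨ â-level (suc (suc p)) ⟩
    kindTotal KA (suc (suc p)) 0          ≡⟨ kindTotal-ground KA (suc p) ⟩
    childTotal KA (suc p) 0               ≡⟨ childTotal-A (suc p) 0 ⟩
    kindTotal W (suc p) 0 + 2 * a + 2 * b ≡⟨ cong (λ w → w + 2 * a + 2 * b) (wingerTotal p) ⟩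
    2 + 2 * a + 2 * b                     ≡⟨ xy∙z≈yz∙x 2 (2 * a) (2 * b) ⟩
    2 * a + 2 * b + 2                     ≡⟨ cong₂ (λ a b → 2 * a + 2 * b + 2) (â-level (suc p)) (b̂-level (suc p)) ⟨
    2 * âₙ q (suc p) + 2 * b̂ₙ q (suc p) + 2 ∎
    where
    a b : ℕ
    a = kindTotal KA (suc p) 0
    b = kindTotal KB (suc p) 0

  b̂-suc : ∀ p → b̂ₙ q (suc (suc p)) ≡ (q ∸ 4) * âₙ q (suc p) + (q ∸ 3) * b̂ₙ q (suc p)
  b̂-suc p = begin
    b̂ₙ q (suc (suc p))            ≡⟨ b̂-level (suc (suc p)) ⟩
    kindTotal KB (suc (suc p)) 0  ≡⟨ kindTotal-ground KB (suc p) ⟩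
    childTotal KB (suc p) 0       ≡⟨ childTotal-B (suc p) 0 ⟩
    (q ∸ 4) * kindTotal KA (suc p) 0 + (q ∸ 3) * kindTotal KB (suc p) 0
      ≡⟨ cong₂ (λ a b → (q ∸ 4) * a + (q ∸ 3) * b) (â-level (suc p)) (b̂-level (suc p)) ⟨
    (q ∸ 4) * âₙ q (suc p) + (q ∸ 3) * b̂ₙ q (suc p) ∎

  ĉ-suc : ∀ p → ĉₙ q (suc (suc p)) ≡ 2 * ĉₙ q (suc p) + 4
  ĉ-suc p = begin
    ĉₙ q (suc (suc p))         ≡⟨ ĉ-level (suc p) ⟩
    upperTotal W (suc p)       ≡⟨ upperTotal-suc W (kindTotal-root W) p ⟩
    diagSum (λ r k → childTotal W r (suc k)) p + (upperTotal W p + kindTotal W (suc p) 0)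
      ≡⟨ cong₂ (λ s w → s + (upperTotal W p + w)) (upperChildTotal-W p) (wingerTotal p) ⟩
    upperTotal W p + 2 + (upperTotal W p + 2) ≡⟨ collect (upperTotal W p) ⟩
    2 * upperTotal W p + 4     ≡⟨ cong (λ c → 2 * c + 4) (ĉ-level p) ⟨
    2 * ĉₙ q (suc p) + 4       ∎
    where
    collect : ∀ c → c + 2 + (c + 2) ≡ 2 * c + 4
    collect = solve-∀

  d̂-suc : ∀ p → d̂ₙ q (suc (suc p)) ≡ âₙ q (suc p) + ĉₙ q (suc p) + 3 * d̂ₙ q (suc p) + 2 * êₙ q (suc p)
  d̂-suc p = begin
    d̂ₙ q (suc (suc p))          ≡⟨ d̂-level (suc p) ⟩
    upperTotal KA (suc p)       ≡⟨ upperTotal-suc KA (kindTotal-root KA) p ⟩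
    diagSum (λ r k → childTotal KA r (suc k)) p + (upperTotal KA p + a)
      ≡⟨ cong (_+ (upperTotal KA p + a)) (upperChildTotal-A p) ⟩
    upperTotal W p + 2 * upperTotal KA p + 2 * upperTotal KB p + (upperTotal KA p + a)
      ≡⟨ collect a (upperTotal W p) (upperTotal KA p) (upperTotal KB p) ⟩
    a + upperTotal W p + 3 * upperTotal KA p + 2 * upperTotal KB p
      ≡⟨ cong₂ (λ a c → a + c + 3 * upperTotal KA p + 2 * upperTotal KB p) (â-level (suc p)) (ĉ-level p) ⟨
    âₙ q (suc p) + ĉₙ q (suc p) + 3 * upperTotal KA p + 2 * upperTotal KB p
      ≡⟨ cong₂ (λ d e → âₙ q (suc p) + ĉₙ q (suc p) + 3 * d + 2 * e) (d̂-level p) (ê-level p) ⟨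
    âₙ q (suc p) + ĉₙ q (suc p) + 3 * d̂ₙ q (suc p) + 2 * êₙ q (suc p) ∎
    where
    a : ℕ
    a = kindTotal KA (suc p) 0
    collect : ∀ a c d e → c + 2 * d + 2 * e + (d + a) ≡ a + c + 3 * d + 2 * e
    collect = solve-∀

  ê-suc : 3 ≤ q → ∀ p →
    êₙ q (suc (suc p)) ≡ b̂ₙ q (suc p) + (q ∸ 4) * d̂ₙ q (suc p) + (q ∸ 2) * êₙ q (suc p)
  ê-suc 3≤q p = begin
    êₙ q (suc (suc p))          ≡⟨ ê-level (suc p) ⟩
    upperTotal KB (suc p)       ≡⟨ upperTotal-suc KB (kindTotal-root KB) p ⟩
    diagSum (λ r k → childTotal KB r (suc k)) p + (upperTotal KB p + b)
      ≡⟨ cong (_+ (upperTotal KB p + b)) (upperChildTotal-B p) ⟩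
    (q ∸ 4) * upperTotal KA p + (q ∸ 3) * upperTotal KB p + (upperTotal KB p + b)
      ≡⟨ collect (q ∸ 4) (q ∸ 3) b (upperTotal KA p) (upperTotal KB p) ⟩
    b + (q ∸ 4) * upperTotal KA p + suc (q ∸ 3) * upperTotal KB p
      ≡⟨ cong (λ n → b + (q ∸ 4) * upperTotal KA p + n * upperTotal KB p) (+-∸-assoc 1 3≤q) ⟨
    b + (q ∸ 4) * upperTotal KA p + (q ∸ 2) * upperTotal KB p
      ≡⟨ cong₂ (λ b d → b + (q ∸ 4) * d + (q ∸ 2) * upperTotal KB p) (b̂-level (suc p)) (d̂-level p) ⟨
    b̂ₙ q (suc p) + (q ∸ 4) * d̂ₙ q (suc p) + (q ∸ 2) * upperTotal KB p
      ≡⟨ cong (λ e → b̂ₙ q (suc p) + (q ∸ 4) * d̂ₙ q (suc p) + (q ∸ 2) * e) (ê-level p) ⟨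
    b̂ₙ q (suc p) + (q ∸ 4) * d̂ₙ q (suc p) + (q ∸ 2) * êₙ q (suc p) ∎
    where
    b : ℕ
    b = kindTotal KB (suc p) 0
    collect : ∀ m n b d e → m * d + n * e + (e + b) ≡ b + m * d + suc n * e
    collect = solve-∀

theorem3 : (q : ℕ) → 5 ≤ q →
    (âₙ q 1 ≡ 0 × b̂ₙ q 1 ≡ 0 × ĉₙ q 1 ≡ 0 × d̂ₙ q 1 ≡ 0 × êₙ q 1 ≡ 0)
    × ((n : ℕ) → 1 ≤ n →
        (âₙ q (suc n) ≡ 2 * âₙ q n + 2 * b̂ₙ q n + 2)
        × (b̂ₙ q (suc n) ≡ (q ∸ 4) * âₙ q n + (q ∸ 3) * b̂ₙ q n)
        × (ĉₙ q (suc n) ≡ 2 * ĉₙ q n + 4)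
        × (d̂ₙ q (suc n) ≡ âₙ q n + ĉₙ q n + 3 * d̂ₙ q n + 2 * êₙ q n)
        × (êₙ q (suc n) ≡ b̂ₙ q n + (q ∸ 4) * d̂ₙ q n + (q ∸ 2) * êₙ q n))
theorem3 q 5≤q =
  (refl , refl , refl , refl , refl) ,
  λ { zero () ; (suc p) _ → â-suc q p , b̂-suc q p , ĉ-suc q p , d̂-suc q p , ê-suc q (≤-trans (s≤s (s≤s (s≤s z≤n))) 5≤q) p }
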